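{- Let $\mathcal{I}=((X,d),(\omega_r,\omega_b,m_r,m_b),(k_1,k_2),(r_1,r_2))$ be a Colorful $2$-NU$k$C instance. Run $\textsc{GreedyClustering}(X,X,r_2,3,\omega_b)$, obtaining centers $M$ and clusters $C(p)$ with $wt(p)=\omega_b(C(p))$. Define $\lambda_b(p)=wt(p)$ for $p\in M$ and $\lambda_b(p)=0$ for $p\in X\setminus M$, and let $\mathcal{I}'=((X,d),(\omega_r,\lambda_b,m_r,m_b),(k_1,k_2),(r'_1,r'_2))$ with $r'_1=r_1+6r_2$ and $r'_2=5r_2$. Then: (a) if $\mathcal{I}$ has a feasible solution, then $\mathcal{I}'$ has a feasible solution that is also structured; (b) given a solution $(\mathcal{B}'_1,\mathcal{B}'_2)$ for $\mathcal{I}'$ (not necessarily structured; covering red weight $\ge m_r$ and blue weight $\ge m_b$ w.r.t. $\omega_r,\lambda_b$) that uses at most $k_i$ balls of radius $\alpha r'_i$ for each $i\in\{1,2\}$, one can obtain a solution $(\mathcal{B}_1,\mathcal{B}_2)$ for $\mathcal{I}$ that uses at most $k_i$ balls of radius $\alpha r'_i+3r_2\le\alpha r_i+(6\alpha+3)r_2$ for $i\in\{1,2\}$.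
   Context: $(X,d)$ is a finite metric space; $B(p,r)=\{q\in X:d(p,q)\le r\}$, balls centered at points of $X$; for $f$ on $X$ and $S\subseteq X$, $f(S)=\sum_{s\in S}f(s)$. A Colorful $2$-NU$k$C instance $((X,d),(\omega_r,\omega_b,m_r,m_b),(k_1,k_2),(r_1,r_2))$ has $r_1\ge r_2\ge0$, $\omega_r,\omega_b:X\to\mathbb{Z}_{\ge0}$; a feasible solution is $(\mathcal{B}_1,\mathcal{B}_2)$ with $\mathcal{B}_i$ at most $k_i$ balls of radius $r_i$ whose covered set $Y$ has $\omega_r(Y)\ge m_r$ and $\omega_b(Y)\ge m_b$. A solution $(\mathcal{B}'_1,\mathcal{B}'_2)$ of $\mathcal{I}'$ is structured if it is a feasible solution of $\mathcal{I}'$ and, letting $Y\subseteq X$ be the set of points $p$ that are either covered by a ball of $\mathcal{B}'_1$ or are the center of some ball in $\mathcal{B}'_2$, we have $\lambda_b(Y)\ge m_b$. $\textsc{GreedyClustering}(Y,X,r,\gamma,\omega)$ (with $Y\subseteq X$, $r\ge0$, $\gamma\ge1$, $\omega:Y\to\mathbb{Z}_{\ge0}$): set $U\leftarrow Y$, $M\leftarrow\emptyset$; while $U\ne\emptyset$: choose $p\in X$ maximizing $\omega(U\cap B(p,r))$ among $q\in X$ with $U\cap B(q,r)\neq\emptyset$ (ties arbitrary); set $C(p)=U\cap B(p,\gamma r)$, $wt(p)=\omega(C(p))$, $U\leftarrow U\setminus C(p)$, $M\leftarrow M\cup\{p\}$. The clusters partition $Y$.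
   Formalization: The distances of the metric $d$, the radii $r_1,r_2$ and the factor $\alpha$ are rational rather than real. -}

module Defs where

open import Data.Nat as ℕ using (ℕ; _≤_)
open import Data.Integer using (+_)
open import Data.Rational as ℚ using (ℚ; 0ℚ; _+_; _*_; _/_) renaming (_≤_ to _≤ℚ_; _<_ to _<ℚ_)
open import Data.Rational.Properties using (_≤?_)
open import Data.Fin using (Fin; _≟_)
open import Data.Fin.Subset using (Subset; ⊥; ⊤; ⁅_⁆; _∩_; _∪_; _─_; Nonempty; Empty)
open import Data.Vec using (tabulate; lookup)
open import Data.Vec as Vec using ()
open import Data.List using (List; []; _∷_; length; foldr; map)
open import Data.Product using (_×_; _,_)
open import Data.Bool using (if_then_else_)
open import Relation.Nullary using (does; ¬_)
open import Relation.Binary.PropositionalEquality using (_≡_)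

num : ℕ → ℚ
num k = (+ k) / 1

record FiniteMetric (n : ℕ) : Set where
  field
    d       : Fin n → Fin n → ℚ
    d-self  : ∀ p → d p p ≡ 0ℚ
    d-pos   : ∀ p q → ¬ (p ≡ q) → 0ℚ <ℚ d p q
    d-sym   : ∀ p q → d p q ≡ d q p
    d-tri   : ∀ p q s → d p s ≤ℚ d p q + d q s

module _ {n : ℕ} (X : FiniteMetric n) where
  open FiniteMetric X

  Ball : Fin n → ℚ → Subset n
  Ball p r = tabulate (λ q → does (d p q ≤? r))

  Cover : List (Fin n) → ℚ → Subset n
  Cover cs r = foldr (λ c S → Ball c r ∪ S) ⊥ cs

wsum : ∀ {n} → (Fin n → ℕ) → Subset n → ℕ
wsum ω S = Vec.sum (tabulate (λ i → if lookup S i then ω i else 0))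

Points : ∀ {n} → List (Fin n) → Subset n
Points cs = foldr (λ c S → ⁅ c ⁆ ∪ S) ⊥ cs

-- A (nondeterministic) execution of GreedyClustering(U, X, r, γ, ω),
-- recorded as the list of pairs (p, C(p)) in the order the centres are chosen.
data GreedyRun {n : ℕ} (X : FiniteMetric n) (r γ : ℚ) (ω : Fin n → ℕ)
     : Subset n → List (Fin n × Subset n) → Set where
  done : ∀ {U} → Empty U → GreedyRun X r γ ω U []
  step : ∀ {U rest} (p : Fin n)
       → Nonempty (U ∩ Ball X p r)
       → (∀ q → Nonempty (U ∩ Ball X q r)
              → wsum ω (U ∩ Ball X q r) ≤ wsum ω (U ∩ Ball X p r))
       → GreedyRun X r γ ω (U ─ (U ∩ Ball X p (γ * r))) rest
       → GreedyRun X r γ ω U ((p , U ∩ Ball X p (γ * r)) ∷ rest)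

lam : ∀ {n} → (Fin n → ℕ) → List (Fin n × Subset n) → Fin n → ℕ
lam ω [] p = 0
lam ω ((c , C) ∷ rest) p = if does (c ≟ p) then wsum ω C else lam ω rest p

Feasible : ∀ {n} → FiniteMetric n → (ωr ωb : Fin n → ℕ) → (mr mb k₁ k₂ : ℕ)
         → (ρ₁ ρ₂ : ℚ) → List (Fin n) → List (Fin n) → Set
Feasible X ωr ωb mr mb k₁ k₂ ρ₁ ρ₂ B₁ B₂ =
  length B₁ ≤ k₁ × length B₂ ≤ k₂ ×
  mr ≤ wsum ωr (Cover X B₁ ρ₁ ∪ Cover X B₂ ρ₂) ×
  mb ≤ wsum ωb (Cover X B₁ ρ₁ ∪ Cover X B₂ ρ₂)

Structured : ∀ {n} → FiniteMetric n → (ωr λb : Fin n → ℕ) → (mr mb k₁ k₂ : ℕ)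
           → (ρ₁ ρ₂ : ℚ) → List (Fin n) → List (Fin n) → Set
Structured X ωr λb mr mb k₁ k₂ ρ₁ ρ₂ B₁ B₂ =
  Feasible X ωr λb mr mb k₁ k₂ ρ₁ ρ₂ B₁ B₂ ×
  mb ≤ wsum λb (Cover X B₁ ρ₁ ∪ Points B₂)

record Instance (n : ℕ) : Set where
  field
    X      : FiniteMetric n
    ωr ωb  : Fin n → ℕ
    mr mb  : ℕ
    k₁ k₂  : ℕ
    r₁ r₂  : ℚ
    r₂≥0   : 0ℚ ≤ℚ r₂
    r₁≥r₂  : r₂ ≤ℚ r₁

{-# OPTIONS --safe #-}
-- Part (a) is a charging argument along the greedy run. Let p be the centre
-- chosen from the uncovered set U, with cluster C = U ∩ B(p, 3r₂). If C meets a
-- first-kind ball B(c, r₁), then d(c, p) ≤ r₁ + 3r₂, so λ(p) = ω(C) is counted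
-- by the first-kind balls enlarged by 6r₂. Otherwise, if a second-kind ball
-- B(q, r₂) meets C, then B(q, r₂) ⊆ B(p, 5r₂) and p takes the place of q. The
-- blue weight that B(q, r₂) loses is at most ω(C): when B(q, r₂) meets
-- U ∩ B(p, r₂), its uncovered points lie in C; when no ball of the solution
-- meets U ∩ B(p, r₂), the greedy choice gives ω(U ∩ B(q, r₂)) ≤ ω(U ∩ B(p, r₂)),
-- and U ∩ B(p, r₂) ⊆ C is disjoint from the rest of the solution. For part (b),
-- λ(p) is the weight of a cluster within 3r₂ of p, so enlarging every ball by
-- 3r₂ recovers it.
module Submission where

open import Defs
open import Data.Bool using (true; false; if_then_else_; _∨_)
open import Data.Fin using (Fin; zero; suc; _≟_)
open import Data.Fin.Subset
  using (Subset; inside; outside; ⊥; ⊤; ⁅_⁆; _∈_; _∉_; _⊆_; _∩_; _∪_; _─_; Nonempty; Empty)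
open import Data.Fin.Subset.Properties
  using ( _∈?_; nonempty?; drop-∷-⊆; drop-∷-Empty; Empty-unique; ∉⊥; ∈⊤; x∈⁅x⁆; x∈⁅y⁆⇒x≡y
        ; x∈p∩q⁺; x∈p∩q⁻; p∩q⊆p; p∩q⊆q; x∈p∪q⁺; x∈p∪q⁻; p⊆p∪q; q⊆p∪q; x∈p∧x∉q⇒x∈p─q; p─q⊆p)
open import Data.List using (List; []; _∷_; length; lookup; removeAt)
open import Data.List.Properties using (length-removeAt′)
open import Data.List.Relation.Unary.Any as Any using (Any; here; there; any?; index)
open import Data.List.Relation.Unary.Any.Properties using (lookup-result)
open import Data.Nat using (ℕ; zero; suc; z≤n; s≤s)
import Data.Nat.Properties as ℕ
open import Data.Product using (Σ; _×_; _,_; proj₁; proj₂)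
open import Data.Sum as Sum using (_⊎_; inj₁; inj₂)
open import Data.Vec using ([]; _∷_; here; there)
open import Function using (_∘_; id)
open import Relation.Nullary using (¬_; does; yes; no; contradiction)
open import Relation.Binary.PropositionalEquality using (_≡_; refl; sym; trans; cong; cong₂; subst)

x∈p─q⇒x∉q : ∀ {n} {x : Fin n} {p q : Subset n} → x ∈ p ─ q → x ∉ q
x∈p─q⇒x∉q {p = _ ∷ _} {outside ∷ _} here ()
x∈p─q⇒x∉q {p = _ ∷ _} {_ ∷ _} (there x∈p─q) (there x∈q) = x∈p─q⇒x∉q x∈p─q x∈q

∪-mono : ∀ {n} {p p′ q q′ : Subset n} → p ⊆ p′ → q ⊆ q′ → p ∪ q ⊆ p′ ∪ q′
∪-mono {p = p} {q = q} p⊆p′ q⊆q′ = x∈p∪q⁺ ∘ Sum.map p⊆p′ q⊆q′ ∘ x∈p∪q⁻ p q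

module _ {n} (p q t : Subset n) where

  ∩-⊆-split : p ∩ t ⊆ (q ∩ t) ∪ ((p ─ q) ∩ t)
  ∩-⊆-split {x} x∈ with x ∈? q | x∈p∩q⁻ p t x∈
  ... | yes x∈q | _ , x∈t = x∈p∪q⁺ (inj₁ (x∈p∩q⁺ (x∈q , x∈t)))
  ... | no x∉q | x∈p , x∈t = x∈p∪q⁺ (inj₂ (x∈p∩q⁺ (x∈p∧x∉q⇒x∈p─q x∈p x∉q , x∈t)))

  ─-∩-⊆ : (p ─ q) ∩ t ⊆ p ∩ t
  ─-∩-⊆ x∈ = let x∈p─q , x∈t = x∈p∩q⁻ _ t x∈ in x∈p∩q⁺ (p─q⊆p p q x∈p─q , x∈t)

  ─-∩-disjoint : Empty (q ∩ ((p ─ q) ∩ t))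
  ─-∩-disjoint (x , x∈) = let x∈q , x∈rest = x∈p∩q⁻ q _ x∈ in x∈p─q⇒x∉q (proj₁ (x∈p∩q⁻ _ t x∈rest)) x∈q

module _ {a q} {A : Set a} {Q : A → Set q} where

  Any-removeAt⁻ : ∀ {xs} (k : Fin (length xs)) → Any Q xs → Q (lookup xs k) ⊎ Any Q (removeAt xs k)
  Any-removeAt⁻ {_ ∷ _} zero (here qx) = inj₁ qx
  Any-removeAt⁻ {_ ∷ _} zero (there qxs) = inj₂ qxs
  Any-removeAt⁻ {_ ∷ _} (suc k) (here qx) = inj₂ (here qx)
  Any-removeAt⁻ {_ ∷ _} (suc k) (there qxs) = Sum.map₂ there (Any-removeAt⁻ k qxs)

  Any-removeAt⁺ : ∀ {xs} (k : Fin (length xs)) → Any Q (removeAt xs k) → Any Q xs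
  Any-removeAt⁺ {_ ∷ _} zero qxs = there qxs
  Any-removeAt⁺ {_ ∷ _} (suc k) (here qx) = here qx
  Any-removeAt⁺ {_ ∷ _} (suc k) (there qxs) = there (Any-removeAt⁺ k qxs)

module WeightedSum where
  open import Algebra.Properties.CommutativeSemigroup ℕ.+-commutativeSemigroup using (interchange)
  open import Data.Nat using (_+_; _≤_)

  private
    variable
      n : ℕ

  wsum-⊥ : (ω : Fin n → ℕ) → wsum ω ⊥ ≡ 0
  wsum-⊥ {zero} ω = refl
  wsum-⊥ {suc n} ω = wsum-⊥ (λ i → ω (suc i))

  wsum-Empty : (ω : Fin n → ℕ) {S : Subset n} → Empty S → wsum ω S ≡ 0
  wsum-Empty ω S-empty rewrite Empty-unique S-empty = wsum-⊥ ω

  wsum-mono : (ω : Fin n → ℕ) {S T : Subset n} → S ⊆ T → wsum ω S ≤ wsum ω T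
  wsum-mono ω {[]} {[]} _ = z≤n
  wsum-mono ω {outside ∷ S} {_ ∷ T} S⊆T = ℕ.+-mono-≤ z≤n (wsum-mono (λ i → ω (suc i)) (drop-∷-⊆ S⊆T))
  wsum-mono ω {inside ∷ S} {inside ∷ T} S⊆T =
    ℕ.+-monoʳ-≤ (ω zero) (wsum-mono (λ i → ω (suc i)) (drop-∷-⊆ S⊆T))
  wsum-mono ω {inside ∷ S} {outside ∷ T} S⊆T = contradiction (S⊆T here) λ ()

  wsum-∪-≤ : (ω : Fin n → ℕ) (S T : Subset n) → wsum ω (S ∪ T) ≤ wsum ω S + wsum ω T
  wsum-∪-≤ ω [] [] = z≤n
  wsum-∪-≤ ω (s ∷ S) (t ∷ T) =
    ℕ.≤-trans (ℕ.+-mono-≤ (head s t) (wsum-∪-≤ ω⁺ S T))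
              (ℕ.≤-reflexive (interchange (if s then ω zero else 0) _ (wsum ω⁺ S) _))
    where
    ω⁺ = λ i → ω (suc i)
    head : ∀ s t → (if s ∨ t then ω zero else 0) ≤ (if s then ω zero else 0) + (if t then ω zero else 0)
    head true  _     = ℕ.m≤m+n _ _
    head false true  = ℕ.≤-refl
    head false false = z≤n

  wsum-∪-disjoint : (ω : Fin n → ℕ) (S T : Subset n) → Empty (S ∩ T) → wsum ω (S ∪ T) ≡ wsum ω S + wsum ω T
  wsum-∪-disjoint ω [] [] _ = refl
  wsum-∪-disjoint ω (s ∷ S) (t ∷ T) disjoint =
    trans (cong₂ _+_ (head s t disjoint) (wsum-∪-disjoint ω⁺ S T (drop-∷-Empty disjoint)))
          (interchange (if s then ω zero else 0) _ (wsum ω⁺ S) _)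
    where
    ω⁺ = λ i → ω (suc i)
    head : ∀ s t → Empty ((s ∷ S) ∩ (t ∷ T)) →
           (if s ∨ t then ω zero else 0) ≡ (if s then ω zero else 0) + (if t then ω zero else 0)
    head true  true  disjoint = contradiction (zero , here) disjoint
    head true  false _        = sym (ℕ.+-identityʳ _)
    head false _     _        = refl

  wsum-disjoint-≤ : (ω : Fin n → ℕ) {S T W : Subset n} → Empty (S ∩ T) → S ⊆ W → T ⊆ W →
                    wsum ω S + wsum ω T ≤ wsum ω W
  wsum-disjoint-≤ ω {S} {T} disjoint S⊆W T⊆W =
    ℕ.≤-trans (ℕ.≤-reflexive (sym (wsum-∪-disjoint ω S T disjoint)))
              (wsum-mono ω (Sum.[ S⊆W , T⊆W ] ∘ x∈p∪q⁻ S T))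

  wsum-zero : (S : Subset n) → wsum (λ _ → 0) S ≡ 0
  wsum-zero [] = refl
  wsum-zero (outside ∷ S) = wsum-zero S
  wsum-zero (inside ∷ S) = wsum-zero S

  wsum-cong : {f g : Fin n → ℕ} → (∀ i → f i ≡ g i) → (S : Subset n) → wsum f S ≡ wsum g S
  wsum-cong f≗g [] = refl
  wsum-cong f≗g (outside ∷ S) = wsum-cong (λ i → f≗g (suc i)) S
  wsum-cong f≗g (inside ∷ S) = cong₂ _+_ (f≗g zero) (wsum-cong (λ i → f≗g (suc i)) S)

  wsum-distrib-+ : (f g : Fin n → ℕ) (S : Subset n) → wsum (λ i → f i + g i) S ≡ wsum f S + wsum g S
  wsum-distrib-+ f g [] = refl
  wsum-distrib-+ f g (outside ∷ S) = wsum-distrib-+ (λ i → f (suc i)) (λ i → g (suc i)) S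
  wsum-distrib-+ f g (inside ∷ S) =
    trans (cong (f zero + g zero +_) (wsum-distrib-+ (λ i → f (suc i)) (λ i → g (suc i)) S))
          (interchange (f zero) (g zero) _ _)

  pointMass : Fin n → ℕ → Fin n → ℕ
  pointMass p v i = if does (p ≟ i) then v else 0

  wsum-pointMass-∈ : ∀ {p : Fin n} {S} v → p ∈ S → wsum (pointMass p v) S ≡ v
  wsum-pointMass-∈ {S = _ ∷ S} v here = trans (cong (v +_) (wsum-zero S)) (ℕ.+-identityʳ v)
  wsum-pointMass-∈ {S = outside ∷ _} v (there p∈S) = wsum-pointMass-∈ v p∈S
  wsum-pointMass-∈ {S = inside ∷ _} v (there p∈S) = wsum-pointMass-∈ v p∈S

  wsum-pointMass-∉ : ∀ {p : Fin n} {S} v → p ∉ S → wsum (pointMass p v) S ≡ 0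
  wsum-pointMass-∉ {p = zero} {outside ∷ S} v _ = wsum-zero S
  wsum-pointMass-∉ {p = zero} {inside ∷ S} v p∉S = contradiction here p∉S
  wsum-pointMass-∉ {p = suc p} {outside ∷ S} v p∉S = wsum-pointMass-∉ v (p∉S ∘ there)
  wsum-pointMass-∉ {p = suc p} {inside ∷ S} v p∉S = wsum-pointMass-∉ v (p∉S ∘ there)

  lam-∷ : (ω : Fin n → ℕ) {p : Fin n} {C : Subset n} (R : List (Fin n × Subset n)) → lam ω R p ≡ 0 →
          ∀ i → lam ω ((p , C) ∷ R) i ≡ pointMass p (wsum ω C) i + lam ω R i
  lam-∷ ω {p} R λp≡0 i with p ≟ i
  ... | yes refl = sym (trans (cong (_ +_) λp≡0) (ℕ.+-identityʳ _))
  ... | no _ = refl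

  wsum-lam-∷ : (ω : Fin n → ℕ) {p : Fin n} {C : Subset n} (R : List (Fin n × Subset n)) → lam ω R p ≡ 0 →
               (S : Subset n) →
               wsum (lam ω ((p , C) ∷ R)) S ≡ wsum (pointMass p (wsum ω C)) S + wsum (lam ω R) S
  wsum-lam-∷ ω {C = C} R λp≡0 S = trans (wsum-cong (lam-∷ ω {C = C} R λp≡0) S) (wsum-distrib-+ _ _ S)

open WeightedSum

module Geometry where
  open import Data.Bool using (T)
  open import Data.Rational using (ℚ; 0ℚ; _+_; _*_; _≤_; _≤ᵇ_; nonNegative)
  open import Data.Rational.Properties
    using ( _≤?_; ≤-trans; ≤-reflexive; +-monoˡ-≤; +-monoʳ-≤; +-mono-≤; +-identityʳ; *-zeroˡ
          ; *-monoʳ-≤-nonNeg; ≤ᵇ⇒≤)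
  open import Data.Rational.Solver using (module +-*-Solver)
  open import Data.Vec.Properties using (lookup∘tabulate; []=⇒lookup; lookup⇒[]=)
  open import Relation.Nullary.Decidable using (dec-true; proof)
  open import Relation.Nullary.Reflects using (Reflects; invert)

  p≤p+q : ∀ {p q} → 0ℚ ≤ q → p ≤ p + q
  p≤p+q {p} 0≤q = ≤-trans (≤-reflexive (sym (+-identityʳ p))) (+-monoʳ-≤ p 0≤q)

  module Multiples {r : ℚ} (0≤r : 0ℚ ≤ r) where

    *r-mono : ∀ {p q} → p ≤ q → p * r ≤ q * r
    *r-mono = *-monoʳ-≤-nonNeg r {{nonNegative 0≤r}}

    num*r-mono : ∀ a b → {T (num a ≤ᵇ num b)} → num a * r ≤ num b * r
    num*r-mono a b {a≤b} = *r-mono {num a} {num b} (≤ᵇ⇒≤ a≤b)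

    0≤num*r : ∀ a → {T (0ℚ ≤ᵇ num a)} → 0ℚ ≤ num a * r
    0≤num*r a {0≤a} = ≤-trans (≤-reflexive (sym (*-zeroˡ r))) (*r-mono {0ℚ} {num a} (≤ᵇ⇒≤ 0≤a))

    open +-*-Solver

    r+r+r≡3r : r + r + r ≡ num 3 * r
    r+r+r≡3r = solve 1 (λ r → r :+ r :+ r := con (num 3) :* r) refl r

    3r+r+r≡5r : num 3 * r + r + r ≡ num 5 * r
    3r+r+r≡5r = solve 1 (λ r → con (num 3) :* r :+ r :+ r := con (num 5) :* r) refl r

    r≤3r : r ≤ num 3 * r
    r≤3r = ≤-trans (≤-reflexive (solve 1 (λ r → r := con (num 1) :* r) refl r)) (num*r-mono 1 3)

    3r≤5r : num 3 * r ≤ num 5 * r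
    3r≤5r = num*r-mono 3 5

    r≤5r : r ≤ num 5 * r
    r≤5r = ≤-trans r≤3r 3r≤5r

  module _ {n : ℕ} (X : FiniteMetric n) where
    open FiniteMetric X

    ∈Ball⁺ : ∀ {p x ρ} → d p x ≤ ρ → x ∈ Ball X p ρ
    ∈Ball⁺ {p} {x} {ρ} h = lookup⇒[]= x _ (trans (lookup∘tabulate _ x) (dec-true (d p x ≤? ρ) h))

    ∈Ball⁻ : ∀ {p x ρ} → x ∈ Ball X p ρ → d p x ≤ ρ
    ∈Ball⁻ {p} {x} {ρ} x∈B =
      invert (subst (Reflects _) (trans (sym (lookup∘tabulate _ x)) ([]=⇒lookup x∈B)) (proof (d p x ≤? ρ)))

    Ball-mono : ∀ {p ρ ρ′} → ρ ≤ ρ′ → Ball X p ρ ⊆ Ball X p ρ′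
    Ball-mono ρ≤ρ′ x∈B = ∈Ball⁺ (≤-trans (∈Ball⁻ x∈B) ρ≤ρ′)

    Ball-⊆-Ball : ∀ {p q z a ρ} → d p z ≤ a → z ∈ Ball X q ρ → Ball X q ρ ⊆ Ball X p (a + ρ + ρ)
    Ball-⊆-Ball {p} {q} {z} {a} {ρ} dpz≤a z∈Bq {x} x∈Bq = ∈Ball⁺ (≤-trans
      (≤-trans (d-tri p q x) (+-monoˡ-≤ (d q x) (d-tri p z q)))
      (+-mono-≤ (+-mono-≤ dpz≤a (≤-trans (≤-reflexive (d-sym z q)) (∈Ball⁻ z∈Bq))) (∈Ball⁻ x∈Bq)))

    ∈Cover⁺ : ∀ {cs ρ x} → Any (λ c → d c x ≤ ρ) cs → x ∈ Cover X cs ρ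
    ∈Cover⁺ (here d≤ρ) = x∈p∪q⁺ (inj₁ (∈Ball⁺ d≤ρ))
    ∈Cover⁺ (there x∈C) = x∈p∪q⁺ (inj₂ (∈Cover⁺ x∈C))

    ∈Cover⁻ : ∀ {cs ρ x} → x ∈ Cover X cs ρ → Any (λ c → d c x ≤ ρ) cs
    ∈Cover⁻ {[]} x∈C = contradiction x∈C ∉⊥
    ∈Cover⁻ {c ∷ cs} {ρ} x∈C with x∈p∪q⁻ (Ball X c ρ) (Cover X cs ρ) x∈C
    ... | inj₁ x∈B = here (∈Ball⁻ x∈B)
    ... | inj₂ x∈C′ = there (∈Cover⁻ x∈C′)

    Cover-mono : ∀ cs {ρ ρ′} → ρ ≤ ρ′ → Cover X cs ρ ⊆ Cover X cs ρ′
    Cover-mono cs {ρ} ρ≤ρ′ = ∈Cover⁺ ∘ Any.map (λ d≤ρ → ≤-trans d≤ρ ρ≤ρ′) ∘ ∈Cover⁻ {cs} {ρ}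

    Cover-grow : ∀ cs {ρ δ x y} → d x y ≤ δ → x ∈ Cover X cs ρ → y ∈ Cover X cs (ρ + δ)
    Cover-grow cs {ρ} {δ} {x} {y} dxy≤δ =
      ∈Cover⁺ ∘ Any.map (λ {c} (dcx≤ρ : d c x ≤ ρ) → ≤-trans (d-tri c x y) (+-mono-≤ dcx≤ρ dxy≤δ))
              ∘ ∈Cover⁻ {cs} {ρ}

    Points⊆Cover : ∀ cs {ρ} → 0ℚ ≤ ρ → Points cs ⊆ Cover X cs ρ
    Points⊆Cover [] _ x∈P = contradiction x∈P ∉⊥
    Points⊆Cover (c ∷ cs) 0≤ρ x∈P with x∈p∪q⁻ ⁅ c ⁆ (Points cs) x∈P
    ... | inj₁ x∈c rewrite x∈⁅y⁆⇒x≡y c x∈c = x∈p∪q⁺ (inj₁ (∈Ball⁺ (≤-trans (≤-reflexive (d-self c)) 0≤ρ)))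
    ... | inj₂ x∈P′ = x∈p∪q⁺ (inj₂ (Points⊆Cover cs 0≤ρ x∈P′))

  radius₁-identity : ∀ α r₁ r → α * (r₁ + num 6 * r) + num 3 * r ≡ α * r₁ + (num 6 * α + num 3) * r
  radius₁-identity = solve 3 (λ α r₁ r → α :* (r₁ :+ con (num 6) :* r) :+ con (num 3) :* r
                                        := α :* r₁ :+ (con (num 6) :* α :+ con (num 3)) :* r) refl
    where open +-*-Solver

  radius₂-bound : ∀ {α r} → 0ℚ ≤ α → 0ℚ ≤ r → α * (num 5 * r) + num 3 * r ≤ α * r + (num 6 * α + num 3) * r
  radius₂-bound {α} {r} 0≤α 0≤r = ≤-trans (p≤p+q (+-mono-≤ 0≤αr 0≤αr)) (≤-reflexive (solve 2
    (λ α r → α :* (con (num 5) :* r) :+ con (num 3) :* r :+ (α :* r :+ α :* r)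
           := α :* r :+ (con (num 6) :* α :+ con (num 3)) :* r) refl α r))
    where
    open +-*-Solver
    0≤αr : 0ℚ ≤ α * r
    0≤αr = ≤-trans (≤-reflexive (sym (*-zeroˡ r))) (*-monoʳ-≤-nonNeg r {{nonNegative 0≤r}} 0≤α)

open Geometry

-- ℚ's _+_ is opened only after the module Greedy, whose charging sums use ℕ's _+_.
open import Data.Rational using (ℚ; 0ℚ; _*_; _≤_)
open import Data.Nat using () renaming (_≤_ to _≤ℕ_)

module Greedy {n} (X : FiniteMetric n) {r : ℚ} (0≤r : 0ℚ ≤ r) (ω : Fin n → ℕ) where
  open import Data.Nat using (_+_)
  open FiniteMetric X
  open Multiples 0≤r
  open ℕ.≤-Reasoning

  Run : Subset n → List (Fin n × Subset n) → Set
  Run = GreedyRun X r (num 3) ω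

  cluster : Subset n → Fin n → Subset n
  cluster U p = U ∩ Ball X p (num 3 * r)

  lam-∉ : ∀ {U R p} → Run U R → Empty (U ∩ Ball X p r) → lam ω R p ≡ 0
  lam-∉ (done _) _ = refl
  lam-∉ {p = p} (step c U∩Bc≠∅ _ run) U∩Bp=∅ with c ≟ p
  ... | yes refl = contradiction U∩Bc≠∅ U∩Bp=∅
  ... | no _ = lam-∉ run λ (x , x∈) → let (x∈U′ , x∈B) = x∈p∩q⁻ _ _ x∈ in
                                      U∩Bp=∅ (x , x∈p∩q⁺ (p─q⊆p _ _ x∈U′ , x∈B))

  module _ {U R} (p : Fin n) (run : Run (U ─ cluster U p) R) where

    lam-centre : lam ω R p ≡ 0
    lam-centre = lam-∉ run λ (x , x∈) →
      let (x∈U′ , x∈B) = x∈p∩q⁻ _ _ x∈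
      in x∈p─q⇒x∉q x∈U′ (x∈p∩q⁺ (p─q⊆p _ _ x∈U′ , Ball-mono X r≤3r x∈B))

    wsum-lam-centre : ∀ S → wsum (lam ω ((p , cluster U p) ∷ R)) S
                          ≡ wsum (pointMass p (wsum ω (cluster U p))) S + wsum (lam ω R) S
    wsum-lam-centre = wsum-lam-∷ ω {C = cluster U p} R lam-centre

    charge-∈ : ∀ {S} → p ∈ S →
               wsum (lam ω ((p , cluster U p) ∷ R)) S ≡ wsum ω (cluster U p) + wsum (lam ω R) S
    charge-∈ {S} p∈S = trans (wsum-lam-centre S) (cong (_+ _) (wsum-pointMass-∈ _ p∈S))

    charge-∉ : ∀ {S} → p ∉ S → wsum (lam ω ((p , cluster U p) ∷ R)) S ≡ wsum (lam ω R) S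
    charge-∉ {S} p∉S = trans (wsum-lam-centre S) (cong (_+ _) (wsum-pointMass-∉ _ p∉S))

    charge-≥ : ∀ S → wsum (lam ω R) S ≤ℕ wsum (lam ω ((p , cluster U p) ∷ R)) S
    charge-≥ S = ℕ.≤-trans (ℕ.m≤n+m _ _) (ℕ.≤-reflexive (sym (wsum-lam-centre S)))

  wsum-lam-≤-neighbourhood : ∀ {U R} → Run U R → {Y E : Subset n} →
    (∀ {p x} → p ∈ Y → d p x ≤ num 3 * r → x ∈ E) → wsum (lam ω R) Y ≤ℕ wsum ω (U ∩ E)
  wsum-lam-≤-neighbourhood (done _) {Y} _ = ℕ.≤-trans (ℕ.≤-reflexive (wsum-zero Y)) z≤n
  wsum-lam-≤-neighbourhood (step {U} {R} p _ _ run) {Y} {E} nbhd with p ∈? Y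
  ... | yes p∈Y = begin
    wsum (lam ω ((p , C) ∷ R)) Y       ≡⟨ charge-∈ p run p∈Y ⟩
    wsum ω C + wsum (lam ω R) Y        ≤⟨ ℕ.+-monoʳ-≤ _ (wsum-lam-≤-neighbourhood run nbhd) ⟩
    wsum ω C + wsum ω ((U ─ C) ∩ E)    ≤⟨ wsum-disjoint-≤ ω (─-∩-disjoint U C E) C⊆U∩E (─-∩-⊆ U C E) ⟩
    wsum ω (U ∩ E)                     ∎
    where
    C = cluster U p
    C⊆U∩E : C ⊆ U ∩ E
    C⊆U∩E x∈C = let x∈U , x∈B = x∈p∩q⁻ U _ x∈C in x∈p∩q⁺ (x∈U , nbhd p∈Y (∈Ball⁻ X x∈B))
  ... | no p∉Y = begin
    wsum (lam ω ((p , C) ∷ R)) Y       ≡⟨ charge-∉ p run p∉Y ⟩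
    wsum (lam ω R) Y                   ≤⟨ wsum-lam-≤-neighbourhood run nbhd ⟩
    wsum ω ((U ─ C) ∩ E)               ≤⟨ wsum-mono ω (─-∩-⊆ U C E) ⟩
    wsum ω (U ∩ E)                     ∎
    where
    C = cluster U p

  module Exchange (A A′ : Subset n) (A-grow : ∀ {p z} → z ∈ A → d p z ≤ num 3 * r → p ∈ A′) where

    covered : List (Fin n) → Subset n
    covered Q = A ∪ Cover X Q r

    anchored : List (Fin n) → Subset n
    anchored P = A′ ∪ Points P

    record Replacement (U : Subset n) (R : List (Fin n × Subset n)) (Q : List (Fin n)) : Set where
      field
        centres : List (Fin n)
        length≤ : length centres ≤ℕ length Q
        covers  : Cover X Q r ⊆ Cover X centres (num 5 * r)
        charged : wsum ω (U ∩ covered Q) ≤ℕ wsum (lam ω R) (anchored centres)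
    open Replacement

    module Step {U R} (p : Fin n)
                (maximal : ∀ q → Nonempty (U ∩ Ball X q r) →
                           wsum ω (U ∩ Ball X q r) ≤ℕ wsum ω (U ∩ Ball X p r))
                (run : Run (U ─ cluster U p) R)
                (ih : ∀ Q → Replacement (U ─ cluster U p) R Q)
                (Q : List (Fin n)) where

      C = cluster U p
      U′ = U ─ C
      core = U ∩ Ball X p r
      R⁺ = (p , C) ∷ R

      meets : Subset n → Fin n → Set
      meets S q = Nonempty (S ∩ Ball X q r)

      split-off-cluster : ∀ T → wsum ω (U ∩ T) ≤ℕ wsum ω (C ∩ T) + wsum ω (U′ ∩ T)
      split-off-cluster T = ℕ.≤-trans (wsum-mono ω (∩-⊆-split U C T)) (wsum-∪-≤ ω (C ∩ T) (U′ ∩ T))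

      charge : ∀ {Q′} P → p ∈ anchored P → anchored (centres (ih Q′)) ⊆ anchored P →
               wsum ω (U ∩ covered Q) ≤ℕ wsum ω C + wsum ω (U′ ∩ covered Q′) →
               wsum ω (U ∩ covered Q) ≤ℕ wsum (lam ω R⁺) (anchored P)
      charge {Q′} P p∈P P′⊆P split = begin
        wsum ω (U ∩ covered Q)                          ≤⟨ split ⟩
        wsum ω C + wsum ω (U′ ∩ covered Q′)             ≤⟨ ℕ.+-monoʳ-≤ _ (charged (ih Q′)) ⟩
        wsum ω C + wsum (lam ω R) (anchored (centres (ih Q′))) ≤⟨ ℕ.+-monoʳ-≤ _ (wsum-mono _ P′⊆P) ⟩
        wsum ω C + wsum (lam ω R) (anchored P)          ≡⟨ charge-∈ p run p∈P ⟨
        wsum (lam ω R⁺) (anchored P)                    ∎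

      exchange-at : (k : Fin (length Q)) → Ball X (lookup Q k) r ⊆ Ball X p (num 5 * r) →
                   wsum ω (U ∩ covered Q) ≤ℕ wsum ω C + wsum ω (U′ ∩ covered (removeAt Q k)) →
                   Replacement U R⁺ Q
      exchange-at k Bq⊆Bp split = record
        { centres = p ∷ P′
        ; length≤ = ℕ.≤-trans (s≤s (length≤ (ih Q′))) (ℕ.≤-reflexive (sym (length-removeAt′ Q k)))
        ; covers  = covers′
        ; charged = charge (p ∷ P′) (q⊆p∪q A′ _ (p⊆p∪q (Points P′) (x∈⁅x⁆ p)))
                           (∪-mono {p = A′} {q = Points P′} id (q⊆p∪q ⁅ p ⁆ (Points P′))) split
        }
        where
        Q′ = removeAt Q k
        P′ = centres (ih Q′)
        covers′ : Cover X Q r ⊆ Cover X (p ∷ P′) (num 5 * r)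
        covers′ x∈ with Any-removeAt⁻ k (∈Cover⁻ X {Q} {r} x∈)
        ... | inj₁ dqx≤r = x∈p∪q⁺ (inj₁ (Bq⊆Bp (∈Ball⁺ X dqx≤r)))
        ... | inj₂ x∈Q′ = x∈p∪q⁺ (inj₂ (covers (ih Q′) (∈Cover⁺ X x∈Q′)))

      keep-centres : wsum ω (U ∩ covered Q) ≤ℕ wsum (lam ω R⁺) (anchored (centres (ih Q))) →
                     Replacement U R⁺ Q
      keep-centres charged′ = record
        { centres = centres (ih Q)
        ; length≤ = length≤ (ih Q)
        ; covers  = covers (ih Q)
        ; charged = charged′
        }

      cluster-meets-A : Nonempty (C ∩ A) → Replacement U R⁺ Q
      cluster-meets-A (z , z∈C∩A) = keep-centres (charge (centres (ih Q)) (p⊆p∪q _ p∈A′) id split)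
        where
        z∈C = proj₁ (x∈p∩q⁻ C A z∈C∩A)
        p∈A′ : p ∈ A′
        p∈A′ = A-grow (proj₂ (x∈p∩q⁻ C A z∈C∩A)) (∈Ball⁻ X (proj₂ (x∈p∩q⁻ U _ z∈C)))
        split : wsum ω (U ∩ covered Q) ≤ℕ wsum ω C + wsum ω (U′ ∩ covered Q)
        split = ℕ.≤-trans (split-off-cluster (covered Q)) (ℕ.+-monoˡ-≤ _ (wsum-mono ω (p∩q⊆p C _)))

      ball-meets-core : Any (meets core) Q → Replacement U R⁺ Q
      ball-meets-core i = exchange-at k (Ball-mono X 3r≤5r ∘ Bq⊆Bp) split
        where
        k = index i
        q = lookup Q k
        z∈core = proj₁ (x∈p∩q⁻ core _ (proj₂ (lookup-result i)))
        z∈Bq = proj₂ (x∈p∩q⁻ core _ (proj₂ (lookup-result i)))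
        Bq⊆Bp : Ball X q r ⊆ Ball X p (num 3 * r)
        Bq⊆Bp = subst (λ ρ → Ball X q r ⊆ Ball X p ρ) r+r+r≡3r
          (Ball-⊆-Ball X {a = r} (∈Ball⁻ X (proj₂ (x∈p∩q⁻ U _ z∈core))) z∈Bq)
        stays : U′ ∩ covered Q ⊆ U′ ∩ covered (removeAt Q k)
        stays {x} x∈ with x∈p∩q⁻ U′ _ x∈
        ... | x∈U′ , x∈cov with x∈p∪q⁻ A _ x∈cov
        ...   | inj₁ x∈A = x∈p∩q⁺ (x∈U′ , x∈p∪q⁺ (inj₁ x∈A))
        ...   | inj₂ x∈CQ with Any-removeAt⁻ k (∈Cover⁻ X {Q} {r} x∈CQ)
        ...     | inj₁ dqx≤r = contradiction (x∈p∩q⁺ (p─q⊆p U C x∈U′ , Bq⊆Bp (∈Ball⁺ X dqx≤r)))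
                                             (x∈p─q⇒x∉q x∈U′)
        ...     | inj₂ x∈Q′ = x∈p∩q⁺ (x∈U′ , x∈p∪q⁺ (inj₂ (∈Cover⁺ X x∈Q′)))
        split : wsum ω (U ∩ covered Q) ≤ℕ wsum ω C + wsum ω (U′ ∩ covered (removeAt Q k))
        split = ℕ.≤-trans (split-off-cluster (covered Q))
                          (ℕ.+-mono-≤ (wsum-mono ω (p∩q⊆p C _)) (wsum-mono ω stays))

      ball-meets-cluster : Empty (C ∩ A) → ¬ Any (meets core) Q → Any (meets C) Q → Replacement U R⁺ Q
      ball-meets-cluster C∩A=∅ ¬core i = exchange-at k Bq⊆Bp split
        where
        k = index i
        q = lookup Q k
        Q′ = removeAt Q k
        z = proj₁ (lookup-result i)
        z∈C = proj₁ (x∈p∩q⁻ C _ (proj₂ (lookup-result i)))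
        z∈Bq = proj₂ (x∈p∩q⁻ C _ (proj₂ (lookup-result i)))
        Bq⊆Bp : Ball X q r ⊆ Ball X p (num 5 * r)
        Bq⊆Bp = subst (λ ρ → Ball X q r ⊆ Ball X p ρ) 3r+r+r≡5r
          (Ball-⊆-Ball X {a = num 3 * r} (∈Ball⁻ X (proj₂ (x∈p∩q⁻ U _ z∈C))) z∈Bq)
        core⊆C : core ⊆ C
        core⊆C x∈ = let x∈U , x∈B = x∈p∩q⁻ U _ x∈ in x∈p∩q⁺ (x∈U , Ball-mono X r≤3r x∈B)
        q-lighter : wsum ω (U ∩ Ball X q r) ≤ℕ wsum ω core
        q-lighter = maximal q (z , x∈p∩q⁺ (proj₁ (x∈p∩q⁻ U _ z∈C) , z∈Bq))
        core-apart : Empty (core ∩ (C ∩ covered Q′))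
        core-apart (x , x∈) with x∈p∩q⁻ core _ x∈
        ... | x∈core , x∈C∩cov with x∈p∪q⁻ A _ (proj₂ (x∈p∩q⁻ C _ x∈C∩cov))
        ...   | inj₁ x∈A = C∩A=∅ (x , x∈p∩q⁺ (core⊆C x∈core , x∈A))
        ...   | inj₂ x∈Q′ = ¬core (Any.map (λ dcx≤r → x , x∈p∩q⁺ (x∈core , ∈Ball⁺ X dcx≤r))
                                          (Any-removeAt⁺ k (∈Cover⁻ X {Q′} {r} x∈Q′)))
        covered-split : U ∩ covered Q ⊆ (U ∩ Ball X q r) ∪ (U ∩ covered Q′)
        covered-split {x} x∈ with x∈p∩q⁻ U _ x∈
        ... | x∈U , x∈cov with x∈p∪q⁻ A _ x∈cov
        ...   | inj₁ x∈A = x∈p∪q⁺ (inj₂ (x∈p∩q⁺ (x∈U , x∈p∪q⁺ (inj₁ x∈A))))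
        ...   | inj₂ x∈CQ with Any-removeAt⁻ k (∈Cover⁻ X {Q} {r} x∈CQ)
        ...     | inj₁ dqx≤r = x∈p∪q⁺ (inj₁ (x∈p∩q⁺ (x∈U , ∈Ball⁺ X dqx≤r)))
        ...     | inj₂ x∈Q′ = x∈p∪q⁺ (inj₂ (x∈p∩q⁺ (x∈U , x∈p∪q⁺ (inj₂ (∈Cover⁺ X x∈Q′)))))
        split : wsum ω (U ∩ covered Q) ≤ℕ wsum ω C + wsum ω (U′ ∩ covered Q′)
        split = begin
          wsum ω (U ∩ covered Q)
            ≤⟨ ℕ.≤-trans (wsum-mono ω covered-split) (wsum-∪-≤ ω (U ∩ Ball X q r) (U ∩ covered Q′)) ⟩
          wsum ω (U ∩ Ball X q r) + wsum ω (U ∩ covered Q′)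
            ≤⟨ ℕ.+-mono-≤ q-lighter (split-off-cluster (covered Q′)) ⟩
          wsum ω core + (wsum ω (C ∩ covered Q′) + wsum ω (U′ ∩ covered Q′))
            ≡⟨ ℕ.+-assoc (wsum ω core) _ _ ⟨
          wsum ω core + wsum ω (C ∩ covered Q′) + wsum ω (U′ ∩ covered Q′)
            ≤⟨ ℕ.+-monoˡ-≤ _ (wsum-disjoint-≤ ω core-apart core⊆C (p∩q⊆p C _)) ⟩
          wsum ω C + wsum ω (U′ ∩ covered Q′) ∎

      cluster-missed : Empty (C ∩ A) → ¬ Any (meets C) Q → Replacement U R⁺ Q
      cluster-missed C∩A=∅ ¬C = keep-centres (begin
        wsum ω (U ∩ covered Q)                   ≤⟨ wsum-mono ω avoids ⟩
        wsum ω (U′ ∩ covered Q)                  ≤⟨ charged (ih Q) ⟩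
        wsum (lam ω R) (anchored (centres (ih Q))) ≤⟨ charge-≥ p run (anchored (centres (ih Q))) ⟩
        wsum (lam ω R⁺) (anchored (centres (ih Q))) ∎)
        where
        avoids : U ∩ covered Q ⊆ U′ ∩ covered Q
        avoids {x} x∈ with x∈p∩q⁻ U _ x∈ | x ∈? C
        ... | x∈U , x∈cov | no x∉C = x∈p∩q⁺ (x∈p∧x∉q⇒x∈p─q x∈U x∉C , x∈cov)
        ... | _ , x∈cov | yes x∈C with x∈p∪q⁻ A _ x∈cov
        ...   | inj₁ x∈A = contradiction (x , x∈p∩q⁺ (x∈C , x∈A)) C∩A=∅
        ...   | inj₂ x∈CQ = contradiction (Any.map (λ dcx≤r → x , x∈p∩q⁺ (x∈C , ∈Ball⁺ X dcx≤r))
                                                   (∈Cover⁻ X {Q} {r} x∈CQ)) ¬C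

      replacement : Replacement U R⁺ Q
      replacement with nonempty? (C ∩ A) | any? (λ q → nonempty? (core ∩ Ball X q r)) Q
                     | any? (λ q → nonempty? (C ∩ Ball X q r)) Q
      ... | yes C∩A≠∅ | _        | _      = cluster-meets-A C∩A≠∅
      ... | no _      | yes i    | _      = ball-meets-core i
      ... | no C∩A=∅  | no ¬core | yes i  = ball-meets-cluster C∩A=∅ ¬core i
      ... | no C∩A=∅  | no _     | no ¬C  = cluster-missed C∩A=∅ ¬C

    exchange : ∀ {U R} → Run U R → ∀ Q → Replacement U R Q
    exchange (done U=∅) Q = record
      { centres = Q
      ; length≤ = ℕ.≤-refl
      ; covers  = Cover-mono X Q r≤5r
      ; charged = ℕ.≤-trans (ℕ.≤-reflexive (wsum-Empty ω λ (x , x∈) → U=∅ (x , proj₁ (x∈p∩q⁻ _ _ x∈)))) z≤n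
      }
    exchange (step p _ maximal run) = Step.replacement p maximal run (exchange run)

open import Data.Rational using (_+_)
import Data.Rational.Properties as ℚ

module _ {n} (I : Instance n) {run : List (Fin n × Subset n)}
         (greedy : GreedyRun (Instance.X I) (Instance.r₂ I) (num 3) (Instance.ωb I) ⊤ run) where
  open Instance I
  open FiniteMetric X
  open Multiples r₂≥0
  open Greedy X r₂≥0 ωb

  feasible⇒structured : ∀ B₁ B₂ → Feasible X ωr ωb mr mb k₁ k₂ r₁ r₂ B₁ B₂ →
    Σ (List (Fin n)) λ B₂′ → Structured X ωr (lam ωb run) mr mb k₁ k₂ (r₁ + num 6 * r₂) (num 5 * r₂) B₁ B₂′
  feasible⇒structured B₁ B₂ (|B₁|≤k₁ , |B₂|≤k₂ , red , blue) =
    P , (|B₁|≤k₁ , ℕ.≤-trans length≤ |B₂|≤k₂ , red′ , blue′) , anchored-blue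
    where
    A′ = Cover X B₁ (r₁ + num 6 * r₂)
    A-grow : ∀ {p z} → z ∈ Cover X B₁ r₁ → d p z ≤ num 3 * r₂ → p ∈ A′
    A-grow {p} {z} z∈A dpz = Cover-mono X B₁ {r₁ + num 3 * r₂} (ℚ.+-monoʳ-≤ r₁ (num*r-mono 3 6))
                               (Cover-grow X B₁ {r₁} (ℚ.≤-trans (ℚ.≤-reflexive (d-sym z p)) dpz) z∈A)
    open Exchange (Cover X B₁ r₁) A′ A-grow
    open Replacement (exchange greedy B₂) renaming (centres to P)
    anchored-blue : mb ≤ℕ wsum (lam ωb run) (A′ ∪ Points P)
    anchored-blue = ℕ.≤-trans blue (ℕ.≤-trans (wsum-mono ωb λ x∈ → x∈p∩q⁺ (∈⊤ , x∈)) charged)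
    red′ : mr ≤ℕ wsum ωr (A′ ∪ Cover X P (num 5 * r₂))
    red′ = ℕ.≤-trans red (wsum-mono ωr (∪-mono (Cover-mono X B₁ {r₁} (p≤p+q (0≤num*r 6))) covers))
    blue′ : mb ≤ℕ wsum (lam ωb run) (A′ ∪ Cover X P (num 5 * r₂))
    blue′ = ℕ.≤-trans anchored-blue
                      (wsum-mono (lam ωb run) (∪-mono {p = A′} id (Points⊆Cover X P (0≤num*r 5))))

  λ-feasible⇒ω-feasible : ∀ ρ₁ ρ₂ B₁ B₂ → Feasible X ωr (lam ωb run) mr mb k₁ k₂ ρ₁ ρ₂ B₁ B₂ →
                          Feasible X ωr ωb mr mb k₁ k₂ (ρ₁ + num 3 * r₂) (ρ₂ + num 3 * r₂) B₁ B₂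
  λ-feasible⇒ω-feasible ρ₁ ρ₂ B₁ B₂ (|B₁|≤k₁ , |B₂|≤k₂ , red , blue) = |B₁|≤k₁ , |B₂|≤k₂ , red′ , blue′
    where
    Y = Cover X B₁ ρ₁ ∪ Cover X B₂ ρ₂
    E = Cover X B₁ (ρ₁ + num 3 * r₂) ∪ Cover X B₂ (ρ₂ + num 3 * r₂)
    neighbourhood : ∀ {p x} → p ∈ Y → d p x ≤ num 3 * r₂ → x ∈ E
    neighbourhood p∈Y dpx =
      x∈p∪q⁺ (Sum.map (Cover-grow X B₁ {ρ₁} dpx) (Cover-grow X B₂ {ρ₂} dpx) (x∈p∪q⁻ _ _ p∈Y))
    red′ : mr ≤ℕ wsum ωr E
    red′ = ℕ.≤-trans red (wsum-mono ωr (∪-mono (Cover-mono X B₁ {ρ₁} (p≤p+q (0≤num*r 3)))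
                                               (Cover-mono X B₂ {ρ₂} (p≤p+q (0≤num*r 3)))))
    blue′ : mb ≤ℕ wsum ωb E
    blue′ = ℕ.≤-trans blue (ℕ.≤-trans (wsum-lam-≤-neighbourhood greedy neighbourhood)
                                      (wsum-mono ωb (p∩q⊆q ⊤ E)))

lemma5 : ∀ {n} (I : Instance n) (run : List (Fin n × Subset n))
  → GreedyRun (Instance.X I) (Instance.r₂ I) (num 3) (Instance.ωb I) ⊤ run
  → let open Instance I
        λb = lam ωb run
        r₁′ = r₁ + num 6 * r₂
        r₂′ = num 5 * r₂
    in (Σ (List (Fin n)) (λ B₁ → Σ (List (Fin n)) (λ B₂ →
          Feasible X ωr ωb mr mb k₁ k₂ r₁ r₂ B₁ B₂))
        → Σ (List (Fin n)) (λ B₁′ → Σ (List (Fin n)) (λ B₂′ →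
          Structured X ωr λb mr mb k₁ k₂ r₁′ r₂′ B₁′ B₂′)))
     × ((α : ℚ) → 0ℚ ≤ α → (B₁′ B₂′ : List (Fin n))
        → Feasible X ωr λb mr mb k₁ k₂ (α * r₁′) (α * r₂′) B₁′ B₂′
        → Σ (List (Fin n)) (λ B₁ → Σ (List (Fin n)) (λ B₂ →
            Feasible X ωr ωb mr mb k₁ k₂
              (α * r₁′ + num 3 * r₂) (α * r₂′ + num 3 * r₂) B₁ B₂
            × (α * r₁′ + num 3 * r₂ ≤ α * r₁ + (num 6 * α + num 3) * r₂)
            × (α * r₂′ + num 3 * r₂ ≤ α * r₂ + (num 6 * α + num 3) * r₂))))
lemma5 I run greedy =
  (λ (B₁ , B₂ , feasible) → B₁ , feasible⇒structured I greedy B₁ B₂ feasible)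
  , λ α 0≤α B₁′ B₂′ feasible →
      B₁′ , B₂′ , λ-feasible⇒ω-feasible I greedy (α * (r₁ + num 6 * r₂)) (α * (num 5 * r₂)) B₁′ B₂′ feasible
      , ℚ.≤-reflexive (radius₁-identity α r₁ r₂) , radius₂-bound 0≤α r₂≥0
  where open Instance I
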